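{- Let $n\ge3$. The hypoplactic congruence $\ddot{\sim}$ on the free monoid $C_n^*$ is not finitely generated (as a monoid congruence). Therefore $\mathrm{hypo}(\mathcal{C}_n)$ has no finite presentation.
   Context: Let $C_n=\{1<2<\cdots<n<\bar n<\overline{n-1}<\cdots<\bar 1\}$; $C_n^*$ is the free monoid of words over $C_n$ and $|w|_a$ the number of occurrences of the letter $a$ in $w$. Convention: the symbols $n+1$ and $\overline{n+1}$ never occur in any word. For $i\in\{1,\dots,n\}$, $w$ has an $i$-inversion if $w=w_1xw_2yw_3$ with $x\in\{i,\overline{i+1}\}$, $y\in\{i+1,\bar i\}$. Quasi-crystal structure on $C_n^*$: $\mathrm{wt}(w)=(|w|_1-|w|_{\bar1},\dots,|w|_n-|w|_{\bar n})\in\mathbb{Z}^n$. For $i\in\{1,\dots,n\}$: if $w$ has an $i$-inversion then $\ddot{\varepsilon}_i(w)=\ddot{\varphi}_i(w)=+\infty$ and $\ddot{e}_i(w),\ddot{f}_i(w)$ are undefined; otherwise $\ddot{\varepsilon}_i(w)=|w|_{i+1}+|w|_{\bar i}$, $\ddot{\varphi}_i(w)=|w|_i+|w|_{\overline{i+1}}$; $\ddot{e}_i(w)$ is defined iff $\ddot{\varepsilon}_i(w)>0$ and is obtained by replacing the right-most letter of $w$ lying in $\{i+1,\bar i\}$ by its image ($i+1\mapsto i$, $\bar i\mapsto\overline{i+1}$ for $i<n$; $\bar n\mapsto n$ for $i=n$); $\ddot{f}_i(w)$ is defined iff $\ddot{\varphi}_i(w)>0$ and is obtained by replacing the left-most letter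 of $w$ lying in $\{i,\overline{i+1}\}$ by its image ($i\mapsto i+1$, $\overline{i+1}\mapsto\bar i$ for $i<n$; $n\mapsto\bar n$ for $i=n$). The connected component $C_n^*(w)$ is the set of words obtained from $w$ by finitely many (defined) applications of the operators $\ddot{e}_i,\ddot{f}_i$. Hypoplactic congruence: $u\ddot{\sim}v$ iff there is a bijection $\psi:C_n^*(u)\to C_n^*(v)$ with $\psi(u)=v$ such that for all $x\in C_n^*(u)$ and $i$: $\psi(x)$ has the same $\mathrm{wt},\ddot{\varepsilon}_i,\ddot{\varphi}_i$ as $x$, $\ddot{e}_i(\psi(x))$ is defined iff $\ddot{e}_i(x)$ is (and then $\psi(\ddot{e}_i(x))=\ddot{e}_i(\psi(x))$), and likewise for $\ddot{f}_i$. It is a monoid congruence on $C_n^*$ and $\mathrm{hypo}(\mathcal{C}_n)=C_n^*/\ddot{\sim}$. -}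

module Defs where

open import Data.Nat using (ℕ; zero; suc; _≡ᵇ_)
open import Data.Fin using (Fin; zero; suc; toℕ)
open import Data.Bool using (Bool; true; false; _∧_; _∨_; if_then_else_)
open import Data.Maybe using (Maybe; just; nothing)
import Data.Maybe as Maybe
open import Data.List using (List; []; _∷_; _++_; concatMap)
open import Data.Product using (_×_; _,_; Σ; ∃; proj₁; proj₂)
open import Data.Integer using (ℤ; +_; _-_)
open import Function.Bundles using (_⇔_)
open import Relation.Binary.PropositionalEquality using (_≡_)
open import Data.List.Membership.Propositional using (_∈_)

-- A letter is either an unbarred letter k or a barred
-- letter k̄, for k ∈ {1,…,n}; the index k is encoded as (j : Fin n) with
-- toℕ j = k - 1.  The order 1<…<n<n̄<…<1̄ is only used through the
-- notion of i-inversion, which is encoded below via X_i and Y_i.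

data Letter (n : ℕ) : Set where
  unb : Fin n → Letter n
  bar : Fin n → Letter n

Word : ℕ → Set
Word n = List (Letter n)

nextFin : ∀ {n} → Fin n → Maybe (Fin n)
nextFin {suc zero} zero = nothing
nextFin {suc (suc n)} zero = just (suc zero)
nextFin {suc (suc n)} (suc i) = Maybe.map suc (nextFin i)

eqFin : ∀ {n} → Fin n → Fin n → Bool
eqFin i j = toℕ i ≡ᵇ toℕ j

isNext : ∀ {n} → Fin n → Fin n → Bool
isNext i j = suc (toℕ i) ≡ᵇ toℕ j

-- X_i = {i, \overline{i+1}}   (for i = n just {n})
isX : ∀ {n} → Fin n → Letter n → Bool
isX i (unb j) = eqFin i j
isX i (bar j) = isNext i j

-- Y_i = {i+1, \bar i}   (for i = n just {\bar n})
isY : ∀ {n} → Fin n → Letter n → Bool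
isY i (unb j) = isNext i j
isY i (bar j) = eqFin i j

count : ∀ {A : Set} → (A → Bool) → List A → ℕ
count p [] = 0
count p (a ∷ w) = if p a then suc (count p w) else count p w

any : ∀ {A : Set} → (A → Bool) → List A → Bool
any p [] = false
any p (a ∷ w) = p a ∨ any p w

hasInv : ∀ {n} → Fin n → Word n → Bool
hasInv i [] = false
hasInv i (a ∷ w) = (isX i a ∧ any (isY i) w) ∨ hasInv i w

wt : ∀ {n} → Word n → Fin n → ℤ
wt w j = + count (λ a → isUnb a) w - + count (λ a → isBar a) w
  where
  isUnb : _ → Bool
  isUnb (unb k) = eqFin j k
  isUnb (bar k) = false
  isBar : _ → Bool
  isBar (unb k) = false
  isBar (bar k) = eqFin j k

data ℕ∞ : Set where
  fin : ℕ → ℕ∞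
  ∞   : ℕ∞

ε̈ : ∀ {n} → Fin n → Word n → ℕ∞
ε̈ i w = if hasInv i w then ∞ else fin (count (isY i) w)

φ̈ : ∀ {n} → Fin n → Word n → ℕ∞
φ̈ i w = if hasInv i w then ∞ else fin (count (isX i) w)

-- image of a letter of X_i under f̈_i
fLetter : ∀ {n} → Fin n → Letter n → Letter n
fLetter i (unb _) with nextFin i
... | just k  = unb k
... | nothing = bar i
fLetter i (bar _) = bar i

-- image of a letter of Y_i under ë_i
eLetter : ∀ {n} → Fin n → Letter n → Letter n
eLetter i (unb _) = unb i
eLetter i (bar _) with nextFin i
... | just k  = bar k
... | nothing = unb i

replaceFirst : ∀ {A : Set} → (A → Bool) → (A → A) → List A → Maybe (List A)
replaceFirst p g [] = nothing
replaceFirst p g (a ∷ w) =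
  if p a then just (g a ∷ w) else Maybe.map (a ∷_) (replaceFirst p g w)

replaceLast : ∀ {A : Set} → (A → Bool) → (A → A) → List A → Maybe (List A)
replaceLast p g [] = nothing
replaceLast p g (a ∷ w) with replaceLast p g w
... | just w' = just (a ∷ w')
... | nothing = if p a then just (g a ∷ w) else nothing

ë : ∀ {n} → Fin n → Word n → Maybe (Word n)
ë i w = if hasInv i w then nothing else replaceLast (isY i) (eLetter i) w

f̈ : ∀ {n} → Fin n → Word n → Maybe (Word n)
f̈ i w = if hasInv i w then nothing else replaceFirst (isX i) (fLetter i) w

data Reach {n : ℕ} (u : Word n) : Word n → Set where
  here  : Reach u u
  via-e : ∀ {x y} (i : Fin n) → Reach u x → ë i x ≡ just y → Reach u y
  via-f : ∀ {x y} (i : Fin n) → Reach u x → f̈ i x ≡ just y → Reach u y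

-- hypoplactic congruence u ~̈ v: a quasi-crystal isomorphism
-- ψ : C_n^*(u) → C_n^*(v) with ψ(u) = v (ψ is given as a function on all
-- words; only its restriction to C_n^*(u) matters).
record IsQCIso {n : ℕ} (u v : Word n) (ψ : Word n → Word n) : Set where
  field
    base   : ψ u ≡ v
    into   : ∀ x → Reach u x → Reach v (ψ x)
    inj    : ∀ x y → Reach u x → Reach u y → ψ x ≡ ψ y → x ≡ y
    surj   : ∀ y → Reach v y → ∃ λ x → Reach u x × ψ x ≡ y
    wt≡    : ∀ x → Reach u x → ∀ j → wt (ψ x) j ≡ wt x j
    ε≡     : ∀ x → Reach u x → ∀ i → ε̈ i (ψ x) ≡ ε̈ i x
    φ≡     : ∀ x → Reach u x → ∀ i → φ̈ i (ψ x) ≡ φ̈ i x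
    e-comm : ∀ x → Reach u x → ∀ i → ë i (ψ x) ≡ Maybe.map ψ (ë i x)
    f-comm : ∀ x → Reach u x → ∀ i → f̈ i (ψ x) ≡ Maybe.map ψ (f̈ i x)

_~̈_ : ∀ {n} → Word n → Word n → Set
u ~̈ v = Σ (Word _ → Word _) (IsQCIso u v)

data CongGen {A : Set} (R : List (List A × List A)) : List A → List A → Set where
  gen   : ∀ {p} → p ∈ R → ∀ s t → CongGen R (s ++ proj₁ p ++ t) (s ++ proj₂ p ++ t)
  refl′ : ∀ {u} → CongGen R u u
  sym′  : ∀ {u v} → CongGen R u v → CongGen R v u
  trans′ : ∀ {u v w} → CongGen R u v → CongGen R v w → CongGen R u w

FinitelyGenerated : {A : Set} → (List A → List A → Set) → Set
FinitelyGenerated {A} _≈_ =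
  Σ (List (List A × List A)) λ R → ∀ u v → (CongGen R u v ⇔ (u ≈ v))

-- hypo(C_n) = C_n^* / ~̈ has a finite presentation: there are a finite
-- alphabet Fin k, a finite list R of defining relations, and a monoid
-- morphism Fin k * → C_n^* / ~̈ (determined by images g of the generators)
-- which is surjective and whose kernel is the congruence generated by R.
HypoFinitelyPresented : ℕ → Set
HypoFinitelyPresented n =
  Σ ℕ λ k → Σ (List (List (Fin k) × List (Fin k))) λ R →
  Σ (Fin k → Word n) λ g →
    (∀ (w : Word n) → ∃ λ u → concatMap g u ~̈ w) ×
    (∀ u v → (concatMap g u ~̈ concatMap g v) ⇔ CongGen R u v)

-- Let K bound the lengths of the finitely many relations (or of the images of the
-- defining relations under a presentation).  The words u = 3 3̄^(K+2) 3 and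
-- v = 3̄ 3 3̄^(K+1) 3 have a 2-inversion (3̄ before 3) and a 3-inversion (3 before 3̄),
-- and no letter meeting X_i ∪ Y_i for any other i; so both are isolated vertices
-- with equal weight and u ~̈ v.  On the other hand, every factor of u of length at
-- most K misses its first or its last letter, hence lacks a 3- or a 2-inversion, and
-- a word over {3, 3̄} without an i-inversion is Y_i^a X_i^b, determined by ε̈_i and
-- φ̈_i.  So no short relation can be applied to u, and u is alone in its class of
-- the generated congruence.  For a presentation the same applies to preimages of
-- u and v, which exist since the one-letter words 3 and 3̄ are determined by ε̈ and φ̈ as well.
module Submission where

open import Defs
open import Data.Nat using (ℕ; zero; suc; _≤_; _<_; _+_; _⊔_; s≤s)
open import Data.Nat.Properties using (≤-trans; m≤m⊔n; m≤n⊔m; m≤m+n; m≤n+m; <⇒≱; ≡⇒≡ᵇ; module ≤-Reasoning)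
open import Data.Fin using (Fin; zero; suc; toℕ)
open import Data.Bool using (Bool; true; false; T; _∨_)
open import Data.Bool.Properties using (∨-conicalˡ; ∨-conicalʳ; ∨-zeroʳ; ∧-zeroʳ)
open import Data.Maybe using (nothing)
import Data.Maybe as Maybe
open import Data.List using (List; []; _∷_; _++_; [_]; replicate; length; concatMap)
open import Data.List.Properties using (length-++; length-replicate; ++-identityʳ; concatMap-++; ∷-injectiveˡ; ∷-injectiveʳ)
open import Data.List.Relation.Unary.All as All using (All; []; _∷_)
open import Data.List.Relation.Unary.All.Properties using (++⁺; ++⁻ˡ; ++⁻ʳ; replicate⁺)
open import Data.List.Relation.Unary.Any using (here; there)
open import Data.List.Membership.Propositional using (_∈_)
open import Data.Product using (_×_; _,_; ∃; proj₁; proj₂)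
open import Data.Sum using (_⊎_; inj₁; inj₂)
open import Function using (id; _∘_)
open import Function.Bundles using (_⇔_; mk⇔; Equivalence)
import Function.Properties.Equivalence as ⇔
open import Relation.Binary.PropositionalEquality using (_≡_; _≢_; refl; sym; trans; cong; cong₂; subst; subst₂; module ≡-Reasoning)
open import Relation.Nullary using (¬_)

data OneOf {A : Set} (a b : A) : A → Set where
  left  : OneOf a b a
  right : OneOf a b b

OneOf-swap : ∀ {A : Set} {a b c : A} → OneOf a b c → OneOf b a c
OneOf-swap left  = right
OneOf-swap right = left

module _ {A : Set} (p : A → Bool) where

  count≡0⇒All : ∀ w → count p w ≡ 0 → All (λ a → p a ≡ false) w
  count≡0⇒All []      _ = []
  count≡0⇒All (a ∷ w) e with p a in pa
  count≡0⇒All (a ∷ w) () | true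
  count≡0⇒All (a ∷ w) e  | false = pa ∷ count≡0⇒All w e

  All⇒count≡0 : ∀ {w} → All (λ a → p a ≡ false) w → count p w ≡ 0
  All⇒count≡0 []         = refl
  All⇒count≡0 (pa ∷ pas) rewrite pa = All⇒count≡0 pas

  All⇒any≡false : ∀ {w} → All (λ a → p a ≡ false) w → any p w ≡ false
  All⇒any≡false []         = refl
  All⇒any≡false (pa ∷ pas) rewrite pa = All⇒any≡false pas

  any-++-∷ʳ : ∀ xs {a} → p a ≡ true → any p (xs ++ [ a ]) ≡ true
  any-++-∷ʳ []       pa rewrite pa = refl
  any-++-∷ʳ (x ∷ xs) pa rewrite any-++-∷ʳ xs pa = ∨-zeroʳ (p x)

  any-++⁻ˡ : ∀ xs {ys} → any p (xs ++ ys) ≡ false → any p xs ≡ false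
  any-++⁻ˡ []       _ = refl
  any-++⁻ˡ (x ∷ xs) e rewrite ∨-conicalˡ (p x) _ e = any-++⁻ˡ xs (∨-conicalʳ (p x) _ e)

  All⇒replaceFirst≡nothing : ∀ g {w} → All (λ a → p a ≡ false) w → replaceFirst p g w ≡ nothing
  All⇒replaceFirst≡nothing g []         = refl
  All⇒replaceFirst≡nothing g (pa ∷ pas) rewrite pa | All⇒replaceFirst≡nothing g pas = refl

  All⇒replaceLast≡nothing : ∀ g {w} → All (λ a → p a ≡ false) w → replaceLast p g w ≡ nothing
  All⇒replaceLast≡nothing g []         = refl
  All⇒replaceLast≡nothing g (pa ∷ pas) rewrite All⇒replaceLast≡nothing g pas | pa = refl

finite-relation-bounded : ∀ {A : Set} (f : A → ℕ) (R : List (A × A)) →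
                        ∃ λ K → ∀ {p} → p ∈ R → f (proj₁ p) ≤ K × f (proj₂ p) ≤ K
finite-relation-bounded f [] = 0 , λ ()
finite-relation-bounded f ((l , r) ∷ R) with finite-relation-bounded f R
... | K , R≤K = f l ⊔ f r ⊔ K , λ
  { (here refl) → ≤-trans (m≤m⊔n (f l) (f r)) (m≤m⊔n _ K)
                , ≤-trans (m≤n⊔m (f l) (f r)) (m≤m⊔n _ K)
  ; (there p∈R) → ≤-trans (proj₁ (R≤K p∈R)) (m≤n⊔m _ K)
                , ≤-trans (proj₂ (R≤K p∈R)) (m≤n⊔m _ K)
  }

module _ {A : Set} where

  ++-∷-prefix-of-∷ʳ : ∀ (xs : List A) {y ys zs z} → xs ++ y ∷ ys ≡ zs ++ [ z ] →
                      ∃ λ ws → xs ++ ws ≡ zs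
  ++-∷-prefix-of-∷ʳ []       {zs = zs}     _ = zs , refl
  ++-∷-prefix-of-∷ʳ (_ ∷ [])    {zs = []} ()
  ++-∷-prefix-of-∷ʳ (_ ∷ _ ∷ _) {zs = []} ()
  ++-∷-prefix-of-∷ʳ (x ∷ xs) {zs = z ∷ zs} e with ++-∷-prefix-of-∷ʳ xs (∷-injectiveʳ e)
  ... | ws , xs++ws≡zs = ws , cong₂ _∷_ (∷-injectiveˡ e) xs++ws≡zs

  gen-∈ : ∀ {R : List (List A × List A)} {p} → p ∈ R → CongGen R (proj₁ p) (proj₂ p)
  gen-∈ {R} {l , r} p∈R = subst₂ (CongGen R) (++-identityʳ l) (++-identityʳ r) (gen p∈R [] [])

  concatMap-preimage : ∀ {B : Set} (g : B → List A) {w} →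
                       All (λ c → ∃ λ x → concatMap g x ≡ [ c ]) w →
                       ∃ λ x → concatMap g x ≡ w
  concatMap-preimage g [] = [] , refl
  concatMap-preimage g ((x , gx) ∷ pres) with concatMap-preimage g pres
  ... | y , gy = x ++ y , trans (concatMap-++ g x y) (cong₂ _++_ gx gy)

Rigid : ∀ {A : Set} → (List A → List A → Set) → ℕ → List A → Set
Rigid _≈_ K u = ∀ s w t {w′} → s ++ w ++ t ≡ u → length w ≤ K → w ≈ w′ → w′ ≡ w

module _ {A B : Set} {_≈_ : List A → List A → Set} (≈-sym : ∀ {x y} → x ≈ y → y ≈ x)
         (h : List B → List A) (h-++ : ∀ x y → h (x ++ y) ≡ h x ++ h y)
         {R : List (List B × List B)} {K : ℕ}
         (R-≈ : ∀ {p} → p ∈ R → h (proj₁ p) ≈ h (proj₂ p))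
         (R-short : ∀ {p} → p ∈ R → length (h (proj₁ p)) ≤ K × length (h (proj₂ p)) ≤ K)
         {u : List A} (u-rigid : Rigid _≈_ K u) where

  private
    h-++³ : ∀ s w t → h (s ++ w ++ t) ≡ h s ++ h w ++ h t
    h-++³ s w t = trans (h-++ s (w ++ t)) (cong (h s ++_) (h-++ w t))

    rewrite-in-fibre : ∀ s l r t → length (h l) ≤ K → h l ≈ h r →
                       h (s ++ l ++ t) ≡ u → h (s ++ r ++ t) ≡ u
    rewrite-in-fibre s l r t short l≈r hslt≡u = begin
      h (s ++ r ++ t)      ≡⟨ h-++³ s r t ⟩
      h s ++ h r ++ h t    ≡⟨ cong (λ z → h s ++ z ++ h t) (u-rigid (h s) (h l) (h t) factor short l≈r) ⟩
      h s ++ h l ++ h t    ≡⟨ factor ⟩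
      u                    ∎
      where
      open ≡-Reasoning
      factor : h s ++ h l ++ h t ≡ u
      factor = trans (sym (h-++³ s l t)) hslt≡u

  rigid-fibre-closed : ∀ {x y} → CongGen R x y → (h x ≡ u ⇔ h y ≡ u)
  rigid-fibre-closed (gen {l , r} p∈R s t) =
    mk⇔ (rewrite-in-fibre s l r t (proj₁ (R-short p∈R)) (R-≈ p∈R))
        (rewrite-in-fibre s r l t (proj₂ (R-short p∈R)) (≈-sym (R-≈ p∈R)))
  rigid-fibre-closed refl′        = ⇔.refl
  rigid-fibre-closed (sym′ c)     = ⇔.sym (rigid-fibre-closed c)
  rigid-fibre-closed (trans′ c d) = ⇔.trans (rigid-fibre-closed c) (rigid-fibre-closed d)

module _ {n : ℕ} where

  record SameStats (u v : Word n) : Set where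
    constructor sameStats
    field
      ε̈≡ : ∀ i → ε̈ i u ≡ ε̈ i v
      φ̈≡ : ∀ i → φ̈ i u ≡ φ̈ i v

  SameStats-sym : ∀ {u v} → SameStats u v → SameStats v u
  SameStats-sym (sameStats ε≡ φ≡) = sameStats (λ i → sym (ε≡ i)) (λ i → sym (φ≡ i))

  ~̈⇒SameStats : ∀ {u v} → u ~̈ v → SameStats u v
  ~̈⇒SameStats {u} (ψ , iso) = sameStats
    (λ i → sym (subst (λ z → ε̈ i z ≡ ε̈ i u) base (ε≡ u here i)))
    (λ i → sym (subst (λ z → φ̈ i z ≡ φ̈ i u) base (φ≡ u here i)))
    where open IsQCIso iso

  Isolated : Word n → Set
  Isolated w = (∀ i → ë i w ≡ nothing) × (∀ i → f̈ i w ≡ nothing)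

  Reach-isolated : ∀ {w x} → Isolated w → Reach w x → x ≡ w
  Reach-isolated iso here = refl
  Reach-isolated iso@(e≡ , _) (via-e i r ex) rewrite Reach-isolated iso r
    with () ← trans (sym ex) (e≡ i)
  Reach-isolated iso@(_ , f≡) (via-f i r fx) rewrite Reach-isolated iso r
    with () ← trans (sym fx) (f≡ i)

  isolated-~̈ : ∀ {u v} → Isolated u → Isolated v → (∀ j → wt v j ≡ wt u j) →
               SameStats v u → u ~̈ v
  isolated-~̈ {u} {v} isoU@(ëu , f̈u) isoV@(ëv , f̈v) wt≡ (sameStats ε≡ φ≡) = (λ _ → v) , record
    { base   = refl
    ; into   = λ _ _ → here
    ; inj    = λ x y rx ry _ → trans (Reach-isolated isoU rx) (sym (Reach-isolated isoU ry))
    ; surj   = λ y ry → u , here , sym (Reach-isolated isoV ry)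
    ; wt≡    = at-u (λ x → ∀ j → wt v j ≡ wt x j) wt≡
    ; ε≡     = at-u (λ x → ∀ i → ε̈ i v ≡ ε̈ i x) ε≡
    ; φ≡     = at-u (λ x → ∀ i → φ̈ i v ≡ φ̈ i x) φ≡
    ; e-comm = at-u (λ x → ∀ i → ë i v ≡ Maybe.map (λ _ → v) (ë i x))
                    (λ i → trans (ëv i) (cong (Maybe.map _) (sym (ëu i))))
    ; f-comm = at-u (λ x → ∀ i → f̈ i v ≡ Maybe.map (λ _ → v) (f̈ i x))
                    (λ i → trans (f̈v i) (cong (Maybe.map _) (sym (f̈u i))))
    }
    where
    at-u : (P : Word n → Set) → P u → ∀ x → Reach u x → P x
    at-u P pu x rx = subst P (sym (Reach-isolated isoU rx)) pu

module _ {n : ℕ} (i : Fin n) where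

  hasInv-noX-++ : ∀ {xs} → All (λ a → isX i a ≡ false) xs → ∀ ys → hasInv i (xs ++ ys) ≡ hasInv i ys
  hasInv-noX-++ []         ys = refl
  hasInv-noX-++ (xa ∷ xas) ys rewrite xa = hasInv-noX-++ xas ys

  hasInv-noX : ∀ {w} → All (λ a → isX i a ≡ false) w → hasInv i w ≡ false
  hasInv-noX {w} xas = trans (cong (hasInv i) (sym (++-identityʳ w))) (hasInv-noX-++ xas [])

  hasInv-noY : ∀ {w} → All (λ a → isY i a ≡ false) w → hasInv i w ≡ false
  hasInv-noY []                 = refl
  hasInv-noY {a ∷ w} (ya ∷ yas)
    rewrite All⇒any≡false (isY i) yas | ∧-zeroʳ (isX i a) = hasInv-noY yas

  hasInv-single : ∀ a → hasInv i [ a ] ≡ false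
  hasInv-single a = cong (_∨ false) (∧-zeroʳ (isX i a))

  hasInv-++⁻ˡ : ∀ w {t} → hasInv i (w ++ t) ≡ false → hasInv i w ≡ false
  hasInv-++⁻ˡ []      _ = refl
  hasInv-++⁻ˡ (a ∷ w) e with isX i a
  ... | false = hasInv-++⁻ˡ w (∨-conicalʳ _ _ e)
  ... | true rewrite any-++⁻ˡ (isY i) w (∨-conicalˡ _ _ e) = hasInv-++⁻ˡ w (∨-conicalʳ _ _ e)

  hasInv-++⁻ʳ : ∀ s {w} → hasInv i (s ++ w) ≡ false → hasInv i w ≡ false
  hasInv-++⁻ʳ []      e = e
  hasInv-++⁻ʳ (a ∷ s) e = hasInv-++⁻ʳ s (∨-conicalʳ _ _ e)

  module _ (w : Word n) (inv : hasInv i w ≡ true) where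

    inverted-ε̈ : ε̈ i w ≡ ∞
    inverted-ε̈ rewrite inv = refl

    inverted-φ̈ : φ̈ i w ≡ ∞
    inverted-φ̈ rewrite inv = refl

    inverted-ë : ë i w ≡ nothing
    inverted-ë rewrite inv = refl

    inverted-f̈ : f̈ i w ≡ nothing
    inverted-f̈ rewrite inv = refl

  ε̈-inversionFree : ∀ w → hasInv i w ≡ false → ε̈ i w ≡ fin (count (isY i) w)
  ε̈-inversionFree w inv rewrite inv = refl

  φ̈-inversionFree : ∀ w → hasInv i w ≡ false → φ̈ i w ≡ fin (count (isX i) w)
  φ̈-inversionFree w inv rewrite inv = refl

  ε̈≡fin⇒ : ∀ w {k} → ε̈ i w ≡ fin k → hasInv i w ≡ false × count (isY i) w ≡ k
  ε̈≡fin⇒ w e with hasInv i w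
  ε̈≡fin⇒ w ()   | true
  ε̈≡fin⇒ w refl | false = refl , refl

  φ̈≡fin⇒ : ∀ w {k} → φ̈ i w ≡ fin k → hasInv i w ≡ false × count (isX i) w ≡ k
  φ̈≡fin⇒ w e with hasInv i w
  φ̈≡fin⇒ w ()   | true
  φ̈≡fin⇒ w refl | false = refl , refl

  module _ {a b : Letter n} (a∉X : isX i a ≡ false) (a∈Y : isY i a ≡ true)
           (b∈X : isX i b ≡ true) (b∉Y : isY i b ≡ false) where

    private
      only-b : ∀ {w} → All (OneOf a b) w → any (isY i) w ≡ false →
               w ≡ replicate (count (isX i) w) b × count (isY i) w ≡ 0
      only-b []           _ = refl , refl
      only-b (left ∷ ab)  e rewrite a∈Y with () ← e
      only-b (right ∷ ab) e rewrite b∈X | b∉Y with only-b ab e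
      ... | w≡bᵏ , noY = cong (b ∷_) w≡bᵏ , noY

    inversionFree-sorted : ∀ {w} → All (OneOf a b) w → hasInv i w ≡ false →
                           w ≡ replicate (count (isY i) w) a ++ replicate (count (isX i) w) b
    inversionFree-sorted []           _ = refl
    inversionFree-sorted (left ∷ ab)  e rewrite a∉X | a∈Y = cong (a ∷_) (inversionFree-sorted ab e)
    inversionFree-sorted (right ∷ ab) e rewrite b∈X | b∉Y with only-b ab (∨-conicalˡ _ _ e)
    ... | w≡bᵏ , noY rewrite noY = cong (b ∷_) w≡bᵏ

    inversionFree-determined : ∀ {w w′} → All (OneOf a b) w → All (OneOf a b) w′ →
                               hasInv i w ≡ false → ε̈ i w′ ≡ ε̈ i w → φ̈ i w′ ≡ φ̈ i w → w′ ≡ w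
    inversionFree-determined {w} {w′} ab ab′ inv ε≡ φ≡ = begin
      w′                                                            ≡⟨ inversionFree-sorted ab′ (proj₁ inv′×#Y) ⟩
      replicate (count (isY i) w′) a ++ replicate (count (isX i) w′) b ≡⟨ cong₂ (λ p q → replicate p a ++ replicate q b) (proj₂ inv′×#Y) #X ⟩
      replicate (count (isY i) w) a ++ replicate (count (isX i) w) b   ≡⟨ sym (inversionFree-sorted ab inv) ⟩
      w                                                             ∎
      where
      open ≡-Reasoning
      inv′×#Y : hasInv i w′ ≡ false × count (isY i) w′ ≡ count (isY i) w
      inv′×#Y = ε̈≡fin⇒ w′ (trans ε≡ (ε̈-inversionFree w inv))
      #X : count (isX i) w′ ≡ count (isX i) w
      #X = proj₂ (φ̈≡fin⇒ w′ (trans φ≡ (φ̈-inversionFree w inv)))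

module Rank≥3 (m : ℕ) where

  N : ℕ
  N = suc (suc (suc m))

  -- The paper's indices 2 and 3 (Fin indices are shifted down by one).
  i₂ i₃ : Fin N
  i₂ = suc zero
  i₃ = suc (suc zero)

  three three̅ : Letter N
  three  = unb i₃
  three̅ = bar i₃

  IsThree : Letter N → Set
  IsThree = OneOf three three̅

  -- The indices i for which 3 and 3̄ lie outside X_i ∪ Y_i.
  data Inert : Fin N → Set where
    inert₁  : Inert zero
    inert≥4 : ∀ j → Inert (suc (suc (suc j)))

  data IndexCase : Fin N → Set where
    inert : ∀ {i} → Inert i → IndexCase i
    at₂   : IndexCase i₂
    at₃   : IndexCase i₃

  index-case : ∀ i → IndexCase i
  index-case zero                = inert inert₁
  index-case (suc zero)          = at₂
  index-case (suc (suc zero))    = at₃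
  index-case (suc (suc (suc j))) = inert (inert≥4 j)

  inert-isX : ∀ {i c} → Inert i → IsThree c → isX i c ≡ false
  inert-isX inert₁      left  = refl
  inert-isX inert₁      right = refl
  inert-isX (inert≥4 j) left  = refl
  inert-isX (inert≥4 j) right = refl

  inert-isY : ∀ {i c} → Inert i → IsThree c → isY i c ≡ false
  inert-isY inert₁      left  = refl
  inert-isY inert₁      right = refl
  inert-isY (inert≥4 j) left  = refl
  inert-isY (inert≥4 j) right = refl

  IsThree-if-inert : ∀ c → (∀ {i} → Inert i → isX i c ≡ false × isY i c ≡ false) → IsThree c
  IsThree-if-inert (unb (suc (suc zero))) _ = left
  IsThree-if-inert (bar (suc (suc zero))) _ = right
  IsThree-if-inert (unb zero)             h with () ← proj₁ (h inert₁)
  IsThree-if-inert (unb (suc zero))       h with () ← proj₂ (h inert₁)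
  IsThree-if-inert (bar zero)             h with () ← proj₂ (h inert₁)
  IsThree-if-inert (bar (suc zero))       h with () ← proj₁ (h inert₁)
  IsThree-if-inert (unb (suc (suc (suc j)))) h
    with () ← subst T (proj₁ (h (inert≥4 j))) (≡⇒≡ᵇ (toℕ j) (toℕ j) refl)
  IsThree-if-inert (bar (suc (suc (suc j)))) h
    with () ← subst T (proj₂ (h (inert≥4 j))) (≡⇒≡ᵇ (toℕ j) (toℕ j) refl)

  module _ {i} (d : Inert i) {w} (w3 : All IsThree w) where

    inert-hasInv : hasInv i w ≡ false
    inert-hasInv = hasInv-noX i (All.map (inert-isX d) w3)

    inert-ε̈ : ε̈ i w ≡ fin 0
    inert-ε̈ = trans (ε̈-inversionFree i w inert-hasInv) (cong fin (All⇒count≡0 (isY i) (All.map (inert-isY d) w3)))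

    inert-φ̈ : φ̈ i w ≡ fin 0
    inert-φ̈ = trans (φ̈-inversionFree i w inert-hasInv) (cong fin (All⇒count≡0 (isX i) (All.map (inert-isX d) w3)))

    inert-ë : ë i w ≡ nothing
    inert-ë rewrite inert-hasInv = All⇒replaceLast≡nothing (isY i) (eLetter i) (All.map (inert-isY d) w3)

    inert-f̈ : f̈ i w ≡ nothing
    inert-f̈ rewrite inert-hasInv = All⇒replaceFirst≡nothing (isX i) (fLetter i) (All.map (inert-isX d) w3)

  SameStats-IsThree : ∀ {w g} → All IsThree w → SameStats w g → All IsThree g
  SameStats-IsThree {w} {g} w3 (sameStats ε≡ φ≡) = All.tabulate λ {c} c∈g →
    IsThree-if-inert c λ d → All.lookup (noX d) c∈g , All.lookup (noY d) c∈g
    where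
    noX : ∀ {i} → Inert i → All (λ c → isX i c ≡ false) g
    noX {i} d = count≡0⇒All (isX i) g (proj₂ (φ̈≡fin⇒ i g (trans (sym (φ≡ i)) (inert-φ̈ d w3))))
    noY : ∀ {i} → Inert i → All (λ c → isY i c ≡ false) g
    noY {i} d = count≡0⇒All (isY i) g (proj₂ (ε̈≡fin⇒ i g (trans (sym (ε≡ i)) (inert-ε̈ d w3))))

  uninverted-SameStats⇒≡ : ∀ {w g} → All IsThree w → hasInv i₂ w ≡ false ⊎ hasInv i₃ w ≡ false →
           SameStats w g → g ≡ w
  uninverted-SameStats⇒≡ w3 (inj₁ inv) w≈g@(sameStats ε≡ φ≡) =
    inversionFree-determined i₂ refl refl refl refl w3 (SameStats-IsThree w3 w≈g)
      inv (sym (ε≡ i₂)) (sym (φ≡ i₂))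
  uninverted-SameStats⇒≡ w3 (inj₂ inv) w≈g@(sameStats ε≡ φ≡) =
    inversionFree-determined i₃ refl refl refl refl
      (All.map OneOf-swap w3) (All.map OneOf-swap (SameStats-IsThree w3 w≈g))
      inv (sym (ε≡ i₃)) (sym (φ≡ i₃))

  DoublyInverted : Word N → Set
  DoublyInverted w = All IsThree w × hasInv i₂ w ≡ true × hasInv i₃ w ≡ true

  doublyInverted-isolated : ∀ {w} → DoublyInverted w → Isolated w
  doublyInverted-isolated {w} (w3 , inv₂ , inv₃) = e , f
    where
    e : ∀ i → ë i w ≡ nothing
    e i with index-case i
    ... | inert d = inert-ë d w3
    ... | at₂     = inverted-ë i₂ w inv₂
    ... | at₃     = inverted-ë i₃ w inv₃
    f : ∀ i → f̈ i w ≡ nothing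
    f i with index-case i
    ... | inert d = inert-f̈ d w3
    ... | at₂     = inverted-f̈ i₂ w inv₂
    ... | at₃     = inverted-f̈ i₃ w inv₃

  doublyInverted-SameStats : ∀ {w w′} → DoublyInverted w → DoublyInverted w′ → SameStats w w′
  doublyInverted-SameStats {w} {w′} (w3 , w₂ , w₃) (w3′ , w₂′ , w₃′) = sameStats ε≡ φ≡
    where
    ε≡ : ∀ i → ε̈ i w ≡ ε̈ i w′
    ε≡ i with index-case i
    ... | inert d = trans (inert-ε̈ d w3) (sym (inert-ε̈ d w3′))
    ... | at₂     = trans (inverted-ε̈ i₂ w w₂) (sym (inverted-ε̈ i₂ w′ w₂′))
    ... | at₃     = trans (inverted-ε̈ i₃ w w₃) (sym (inverted-ε̈ i₃ w′ w₃′))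
    φ≡ : ∀ i → φ̈ i w ≡ φ̈ i w′
    φ≡ i with index-case i
    ... | inert d = trans (inert-φ̈ d w3) (sym (inert-φ̈ d w3′))
    ... | at₂     = trans (inverted-φ̈ i₂ w w₂) (sym (inverted-φ̈ i₂ w′ w₂′))
    ... | at₃     = trans (inverted-φ̈ i₃ w w₃) (sym (inverted-φ̈ i₃ w′ w₃′))

  u v : ℕ → Word N
  u K = three ∷ (replicate (suc (suc K)) three̅ ++ [ three ])
  v K = three̅ ∷ three ∷ (replicate (suc K) three̅ ++ [ three ])

  u-doublyInverted : ∀ K → DoublyInverted (u K)
  u-doublyInverted K =
    left ∷ ++⁺ (replicate⁺ (suc (suc K)) right) (left ∷ []) ,
    cong (_∨ hasInv i₂ (replicate (suc K) three̅ ++ [ three ])) (any-++-∷ʳ (isY i₂) (replicate K three̅) refl) ,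
    refl

  v-doublyInverted : ∀ K → DoublyInverted (v K)
  v-doublyInverted K = right ∷ left ∷ ++⁺ (replicate⁺ (suc K) right) (left ∷ []) , refl , refl

  wt-v≡wt-u : ∀ K j → wt (v K) j ≡ wt (u K) j
  wt-v≡wt-u K zero                = refl
  wt-v≡wt-u K (suc zero)          = refl
  wt-v≡wt-u K (suc (suc zero))    = refl
  wt-v≡wt-u K (suc (suc (suc j))) = refl

  u~̈v : ∀ K → u K ~̈ v K
  u~̈v K = isolated-~̈ (doublyInverted-isolated (u-doublyInverted K))
                      (doublyInverted-isolated (v-doublyInverted K))
                      (wt-v≡wt-u K)
                      (doublyInverted-SameStats (v-doublyInverted K) (u-doublyInverted K))

  v≢u : ∀ {K} → v K ≢ u K
  v≢u ()

  K<|u| : ∀ K → K < length (u K)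
  K<|u| K = s≤s (begin
    K                                                      ≤⟨ m≤n+m K 2 ⟩
    suc (suc K)                                            ≤⟨ m≤m+n _ 1 ⟩
    suc (suc K) + 1                                        ≡⟨ cong (_+ 1) (sym (length-replicate (suc (suc K)))) ⟩
    length (replicate (suc (suc K)) three̅) + 1             ≡⟨ sym (length-++ (replicate (suc (suc K)) three̅)) ⟩
    length (replicate (suc (suc K)) three̅ ++ [ three ])    ∎)
    where open ≤-Reasoning

  -- A short factor misses the first letter of u (no 3 before 3̄) or its last
  -- letter (no 3̄ before 3).
  short-factor-uninverted : ∀ K s w t → s ++ w ++ t ≡ u K → length w ≤ K →
                            hasInv i₂ w ≡ false ⊎ hasInv i₃ w ≡ false
  short-factor-uninverted K (_ ∷ s) w t e _ =
    inj₂ (hasInv-++⁻ˡ i₃ w (hasInv-++⁻ʳ i₃ s (trans (cong (hasInv i₃) (∷-injectiveʳ e)) tail-uninverted)))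
    where
    tail-uninverted : hasInv i₃ (replicate (suc (suc K)) three̅ ++ [ three ]) ≡ false
    tail-uninverted = hasInv-noX-++ i₃ {replicate (suc (suc K)) three̅} (replicate⁺ (suc (suc K)) refl) [ three ]
  short-factor-uninverted K [] w [] e short
    with () ← <⇒≱ (K<|u| K) (subst (_≤ K) (cong length (trans (sym (++-identityʳ w)) e)) short)
  short-factor-uninverted K [] w (_ ∷ t) e _ with ++-∷-prefix-of-∷ʳ w {zs = three ∷ replicate (suc (suc K)) three̅} e
  ... | t′ , w++t′≡init =
    inj₁ (hasInv-++⁻ˡ i₂ w (trans (cong (hasInv i₂) w++t′≡init) init-uninverted))
    where
    init-uninverted : hasInv i₂ (three ∷ replicate (suc (suc K)) three̅) ≡ false
    init-uninverted = hasInv-noY i₂ {replicate (suc (suc K)) three̅} (replicate⁺ (suc (suc K)) refl)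

  u-rigid : ∀ K → Rigid SameStats K (u K)
  u-rigid K s w t e short = uninverted-SameStats⇒≡ w3 (short-factor-uninverted K s w t e short)
    where
    w3 : All IsThree w
    w3 = ++⁻ˡ w (++⁻ʳ s (subst (All IsThree) (sym e) (proj₁ (u-doublyInverted K))))

  ¬CongGen-u-v : ∀ {B : Set} (h : List B → Word N) → (∀ x y → h (x ++ y) ≡ h x ++ h y) →
                 ∀ {R K} → (∀ {p} → p ∈ R → SameStats (h (proj₁ p)) (h (proj₂ p))) →
                 (∀ {p} → p ∈ R → length (h (proj₁ p)) ≤ K × length (h (proj₂ p)) ≤ K) →
                 ∀ {x y} → h x ≡ u K → h y ≡ v K → ¬ CongGen R x y
  ¬CongGen-u-v h h-++ {K = K} R-≈ R-short hx hy c =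
    v≢u (trans (sym hy) (Equivalence.to (rigid-fibre-closed SameStats-sym h h-++ R-≈ R-short (u-rigid K) c) hx))

  IsThree-preimage : ∀ {k} (g : Fin k → Word N) → (∀ w → ∃ λ x → concatMap g x ~̈ w) →
                     ∀ {w} → All IsThree w → ∃ λ x → concatMap g x ≡ w
  IsThree-preimage g g-onto w3 = concatMap-preimage g (All.map letter-preimage w3)
    where
    letter-preimage : ∀ {c} → IsThree c → ∃ λ x → concatMap g x ≡ [ c ]
    letter-preimage {c} c3 with g-onto [ c ]
    ... | x , gx~c = x , uninverted-SameStats⇒≡ (c3 ∷ []) (inj₁ (hasInv-single i₂ c)) (SameStats-sym (~̈⇒SameStats gx~c))

  not-finitelyGenerated : ¬ FinitelyGenerated (_~̈_ {N})
  not-finitelyGenerated (R , R-generates) with finite-relation-bounded length R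
  ... | K , R-short =
    ¬CongGen-u-v id (λ _ _ → refl) R-≈ R-short refl refl
      (Equivalence.from (R-generates (u K) (v K)) (u~̈v K))
    where
    R-≈ : ∀ {p} → p ∈ R → SameStats (proj₁ p) (proj₂ p)
    R-≈ p∈R = ~̈⇒SameStats (Equivalence.to (R-generates _ _) (gen-∈ p∈R))

  not-finitelyPresented : ¬ HypoFinitelyPresented N
  not-finitelyPresented (k , R , g , g-onto , R-presents)
    with finite-relation-bounded (length ∘ concatMap g) R
  ... | K , R-short
    with IsThree-preimage g g-onto (proj₁ (u-doublyInverted K))
       | IsThree-preimage g g-onto (proj₁ (v-doublyInverted K))
  ... | x , gx≡u | y , gy≡v =
    ¬CongGen-u-v (concatMap g) (concatMap-++ g) R-≈ R-short gx≡u gy≡v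
      (Equivalence.to (R-presents x y) (subst₂ _~̈_ (sym gx≡u) (sym gy≡v) (u~̈v K)))
    where
    R-≈ : ∀ {p} → p ∈ R → SameStats (concatMap g (proj₁ p)) (concatMap g (proj₂ p))
    R-≈ p∈R = ~̈⇒SameStats (Equivalence.from (R-presents _ _) (gen-∈ p∈R))

theorem9p39 : (n : ℕ) → 3 ≤ n →
    ¬ FinitelyGenerated (_~̈_ {n}) × ¬ HypoFinitelyPresented n
theorem9p39 (suc (suc zero)) (s≤s (s≤s ()))
theorem9p39 (suc (suc (suc m))) _ = Rank≥3.not-finitelyGenerated m , Rank≥3.not-finitelyPresented m
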